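{- Let $W$ be an $\aleph_0$-homogeneous closure space in which $\emptyset$ is closed. Then for any $a, c \in |W|$ there is an automorphism of $W$ sending $a$ to $c$; and for any $a, b, c, d \in |W|$ with $b \notin \mathrm{cl}(\{a\})$ and $d \notin \mathrm{cl}(\{c\})$, there is an automorphism $h$ of $W$ with $h(a) = c$ and $h(b) = d$. In particular, if $W$ fails exchange over $\emptyset$, then $I(W)$ is a dense linear order without endpoints.
   Context: A closure space is a pair $W = (X, \mathrm{cl})$ where $X$ is a set (written $|W|$) and $\mathrm{cl} : \mathcal{P}(X) \to \mathcal{P}(X)$ satisfies: $A \subseteq \mathrm{cl}(A)$ for all $A \subseteq X$, and $A \subseteq \mathrm{cl}(B)$ implies $\mathrm{cl}(A) \subseteq \mathrm{cl}(B)$. A set $A$ is closed if $\mathrm{cl}(A) = A$. An automorphism of $W$ is a bijection $f : |W| \to |W|$ with $f[\mathrm{cl}(A)] = \mathrm{cl}(f[A])$ for all $A$. For an infinite cardinal $\mu$, $W$ is $\mu$-homogeneous if for every $A \subseteq |W|$ with $|A| < \mu$ and all $a, b \in |W| \setminus \mathrm{cl}(A)$ there is an automorphism of $W$ fixing $A$ pointwise and sending $a$ to $b$. $W$ has exchange over $\emptyset$ if for all $a, b$, $a \in \mathrm{cl}(\{b\}) \setminus \mathrm{cl}(\emptyset)$ implies $b \in \mathrm{cl}(\{a\})$. For $a, b \in |W|$ write $a \le b$ if $a \in \mathrm{cl}(\{b\})$ (a preorder), and $a \sim b$ if $a \le b$ and $b \le a$; $I(W)$ is the partial order on $|W|/\sim$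 induced by $\le$. -}

module Defs where

open import Level using (Level; suc; _⊔_)
open import Data.Empty.Polymorphic using (⊥)
open import Data.Product using (Σ; ∃; ∃-syntax; _×_; _,_)
open import Data.Sum using (_⊎_)
open import Data.List using (List)
open import Data.List.Membership.Propositional using (_∈_)
open import Relation.Nullary using (¬_)
open import Relation.Unary using (Pred; _⊆_; _≐_)
open import Relation.Binary.PropositionalEquality using (_≡_)
open import Function.Definitions using (Bijective)

record ClosureSpace (ℓ : Level) : Set (suc ℓ) where
  field
    Carrier   : Set ℓ
    cl        : Pred Carrier ℓ → Pred Carrier ℓ
    extensive : ∀ (A : Pred Carrier ℓ) → A ⊆ cl A
    cl-le     : ∀ (A B : Pred Carrier ℓ) → A ⊆ cl B → cl A ⊆ cl B

module _ {ℓ : Level} (W : ClosureSpace ℓ) where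
  open ClosureSpace W

  ∅ˢ : Pred Carrier ℓ
  ∅ˢ _ = ⊥

  ⟦_⟧ : Carrier → Pred Carrier ℓ
  ⟦ b ⟧ x = x ≡ b

  listSet : List Carrier → Pred Carrier ℓ
  listSet As x = x ∈ As

  image : (Carrier → Carrier) → Pred Carrier ℓ → Pred Carrier ℓ
  image f A y = ∃[ x ] (A x × f x ≡ y)

  IsClosed : Pred Carrier ℓ → Set ℓ
  IsClosed A = cl A ≐ A

  IsAutomorphism : (Carrier → Carrier) → Set (suc ℓ)
  IsAutomorphism f = Bijective _≡_ _≡_ f
                   × (∀ (A : Pred Carrier ℓ) → image f (cl A) ≐ cl (image f A))

  -- ℵ₀-homogeneity: subsets of size < ℵ₀ are exactly the finite ones,
  -- i.e. the sets of elements of finite lists.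
  ℵ₀-Homogeneous : Set (suc ℓ)
  ℵ₀-Homogeneous =
    ∀ (As : List Carrier) (a b : Carrier) →
      ¬ cl (listSet As) a → ¬ cl (listSet As) b →
      ∃[ f ] (IsAutomorphism f × (∀ {x} → x ∈ As → f x ≡ x) × f a ≡ b)

  ExchangeOver∅ : Set ℓ
  ExchangeOver∅ = ∀ (a b : Carrier) → cl ⟦ b ⟧ a → ¬ cl ∅ˢ a → cl ⟦ a ⟧ b

  _≤ᶜ_ : Carrier → Carrier → Set ℓ
  a ≤ᶜ b = cl ⟦ b ⟧ a

  _<ᶜ_ : Carrier → Carrier → Set ℓ
  a <ᶜ b = a ≤ᶜ b × ¬ (b ≤ᶜ a)

  -- I(W) = Carrier/∼ with the induced order is a dense linear order without
  -- endpoints (stated on representatives; the quotient order is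
  -- automatically antisymmetric).
  IsDLOWithoutEndpoints : Set ℓ
  IsDLOWithoutEndpoints =
      (∃ λ (a : Carrier) → a ≡ a)
    × (∀ a b → a ≤ᶜ b ⊎ b ≤ᶜ a)
    × (∀ a b → a <ᶜ b → ∃[ c ] (a <ᶜ c × c <ᶜ b))
    × (∀ a → ∃[ b ] (a <ᶜ b))
    × (∀ a → ∃[ b ] (b <ᶜ a))

-- Since cl ∅ = ∅, ℵ₀-homogeneity over the empty set makes the automorphism group
-- transitive; composing with an automorphism fixing the (now common) first point
-- gives transitivity on pairs (a, b) with b ∉ cl {a}.  If exchange fails there is
-- such a pair with a < b, and transporting it by automorphisms yields linearity
-- (any x, y with y ≰ x form such a pair, hence x ≤ y), unboundedness in both
-- directions and density: for x < y pick z > y and move (x, z) to (x, y); the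
-- image of y lies strictly between x and y.
module Submission where

open import Defs
open import Level using (Level)
open import Function using (_∘_)
open import Function.Construct.Composition using (bijective)
open import Data.Empty using (⊥-elim)
open import Data.Product using (∃; ∃-syntax; _×_; _,_; proj₁; proj₂)
open import Data.Sum using (_⊎_; inj₁; inj₂)
open import Data.List using ([]; _∷_)
open import Data.List.Relation.Unary.Any using (here)
open import Relation.Nullary using (¬_; yes; no)
open import Relation.Unary using (Pred; _⊆_; _≐_)
open import Relation.Binary.PropositionalEquality using (_≡_; refl; subst)
open import Axiom.ExcludedMiddle using (ExcludedMiddle)

module ClosureSpaceProperties {ℓ : Level} (W : ClosureSpace ℓ) where
  open ClosureSpace W

  infix 4 _≤_ _<_

  _≤_ _<_ : Carrier → Carrier → Set ℓ
  _≤_ = _≤ᶜ_ W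
  _<_ = _<ᶜ_ W

  cl-mono : ∀ {A B : Pred Carrier ℓ} → A ⊆ B → cl A ⊆ cl B
  cl-mono {A} {B} A⊆B = cl-le A B (extensive B ∘ A⊆B)

  ≤-trans : ∀ {x y z} → x ≤ y → y ≤ z → x ≤ z
  ≤-trans {y = y} {z} x≤y y≤z = cl-le (⟦_⟧ W y) (⟦_⟧ W z) (λ { refl → y≤z }) x≤y

  image-mono : ∀ f {A B : Pred Carrier ℓ} → A ⊆ B → image W f A ⊆ image W f B
  image-mono f A⊆B (x , x∈A , refl) = x , A⊆B x∈A , refl

  image-∘ : ∀ f g (A : Pred Carrier ℓ) → image W (g ∘ f) A ≐ image W g (image W f A)
  image-∘ f g A = (λ { (x , x∈A , refl) → f x , (x , x∈A , refl) , refl })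
                , (λ { (_ , (x , x∈A , refl) , refl) → x , x∈A , refl })

  image-⟦⟧ : ∀ f b → image W f (⟦_⟧ W b) ≐ ⟦_⟧ W (f b)
  image-⟦⟧ f b = (λ { (_ , refl , refl) → refl }) , (λ { refl → b , refl , refl })

  ∘-isAutomorphism : ∀ {f g} → IsAutomorphism W f → IsAutomorphism W g →
                     IsAutomorphism W (g ∘ f)
  ∘-isAutomorphism {f} {g} (f-bij , f-cl) (g-bij , g-cl) =
    bijective _≡_ _≡_ _≡_ f-bij g-bij , λ A →
      ( cl-mono (proj₂ (image-∘ f g A))
      ∘ proj₁ (g-cl (image W f A))
      ∘ image-mono g (proj₁ (f-cl A))
      ∘ proj₁ (image-∘ f g (cl A)) )
    , ( proj₂ (image-∘ f g (cl A))
      ∘ image-mono g (proj₂ (f-cl A))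
      ∘ proj₂ (g-cl (image W f A))
      ∘ cl-mono (proj₁ (image-∘ f g A)) )

  module _ {f} (f-aut : IsAutomorphism W f) where

    aut-preserves-≤ : ∀ {a b} → a ≤ b → f a ≤ f b
    aut-preserves-≤ {a} {b} a≤b =
      cl-mono (proj₁ (image-⟦⟧ f b)) (proj₁ (proj₂ f-aut (⟦_⟧ W b)) (a , a≤b , refl))

    aut-reflects-≤ : ∀ {a b} → f a ≤ f b → a ≤ b
    aut-reflects-≤ {a} {b} fa≤fb
      with proj₂ (proj₂ f-aut (⟦_⟧ W b)) (cl-mono (proj₂ (image-⟦⟧ f b)) fa≤fb)
    ... | _ , x≤b , fx≡fa = subst (_≤ b) (proj₁ (proj₁ f-aut) fx≡fa) x≤b

    aut-preserves-< : ∀ {a b} → a < b → f a < f b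
    aut-preserves-< (a≤b , b≰a) = aut-preserves-≤ a≤b , b≰a ∘ aut-reflects-≤

  PointTransitive : Set (Level.suc ℓ)
  PointTransitive = ∀ a c → ∃[ h ] (IsAutomorphism W h × h a ≡ c)

  IndependentPairTransitive : Set (Level.suc ℓ)
  IndependentPairTransitive = ∀ a b c d → ¬ b ≤ a → ¬ d ≤ c →
    ∃[ h ] (IsAutomorphism W h × h a ≡ c × h b ≡ d)

  module Homogeneous (homogeneous : ℵ₀-Homogeneous W) (∅-closed : IsClosed W (∅ˢ W)) where

    cl[]-empty : ∀ a → ¬ cl (listSet W []) a
    cl[]-empty a a∈cl[] with proj₁ ∅-closed (cl-mono (λ ()) a∈cl[])
    ... | ()

    pointTransitive : PointTransitive
    pointTransitive a c
      with homogeneous [] a c (cl[]-empty a) (cl[]-empty c)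
    ... | h , h-aut , _ , ha≡c = h , h-aut , ha≡c

    independentPairTransitive : IndependentPairTransitive
    independentPairTransitive a b c d b≰a d≰c with pointTransitive a c
    ... | f , f-aut , refl
      with homogeneous (f a ∷ []) (f b) d (b≰a ∘ aut-reflects-≤ f-aut ∘ cl-mono singleton)
                                          (d≰c ∘ cl-mono singleton)
      where
      singleton : listSet W (f a ∷ []) ⊆ ⟦_⟧ W (f a)
      singleton (here x≡fa) = x≡fa
    ... | g , g-aut , g-fixes , gfb≡d =
      g ∘ f , ∘-isAutomorphism f-aut g-aut , g-fixes (here refl) , gfb≡d

  ¬exchange⇒∃< : ExcludedMiddle ℓ → ¬ ExchangeOver∅ W → ∃[ a ] ∃[ b ] a < b
  ¬exchange⇒∃< EM ¬exchange with EM {∃[ a ] ∃[ b ] a < b}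
  ... | yes a<b = a<b
  ... | no ∄a<b = ⊥-elim (¬exchange λ a b a≤b _ → ≤-symmetric a b a≤b)
    where
    ≤-symmetric : ∀ a b → a ≤ b → b ≤ a
    ≤-symmetric a b a≤b with EM {b ≤ a}
    ... | yes b≤a = b≤a
    ... | no b≰a = ⊥-elim (∄a<b (a , b , a≤b , b≰a))

  module StrictPair (EM : ExcludedMiddle ℓ)
                    (pointTransitive : PointTransitive)
                    (independentPairTransitive : IndependentPairTransitive)
                    {a₀ b₀ : Carrier} (a₀<b₀ : a₀ < b₀) where

    ≤-total : ∀ x y → x ≤ y ⊎ y ≤ x
    ≤-total x y with EM {y ≤ x}
    ... | yes y≤x = inj₂ y≤x
    ... | no y≰x with independentPairTransitive a₀ b₀ x y (proj₂ a₀<b₀) y≰x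
    ...   | h , h-aut , refl , refl = inj₁ (aut-preserves-≤ h-aut (proj₁ a₀<b₀))

    no-greatest : ∀ x → ∃[ y ] x < y
    no-greatest x with pointTransitive a₀ x
    ... | h , h-aut , refl = h b₀ , aut-preserves-< h-aut a₀<b₀

    no-least : ∀ x → ∃[ y ] y < x
    no-least x with pointTransitive b₀ x
    ... | h , h-aut , refl = h a₀ , aut-preserves-< h-aut a₀<b₀

    dense : ∀ x y → x < y → ∃[ c ] (x < c × c < y)
    dense x y x<y@(_ , y≰x) with no-greatest y
    ... | z , y<z@(y≤z , _)
      with independentPairTransitive x z x y (y≰x ∘ ≤-trans y≤z) y≰x
    ... | h , h-aut , hx≡x , hz≡y =
      h y , subst (_< h y) hx≡x (aut-preserves-< h-aut x<y)
          , subst (h y <_) hz≡y (aut-preserves-< h-aut y<z)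

    isDLOWithoutEndpoints : IsDLOWithoutEndpoints W
    isDLOWithoutEndpoints = (a₀ , refl) , ≤-total , dense , no-greatest , no-least

lemma2p9 : {ℓ : Level} → (∀ {ℓ′} → ExcludedMiddle ℓ′) → (W : ClosureSpace ℓ) →
    ℵ₀-Homogeneous W → IsClosed W (∅ˢ W) →
    (∀ (a c : ClosureSpace.Carrier W) →
    ∃[ h ] (IsAutomorphism W h × h a ≡ c))
    × (∀ (a b c d : ClosureSpace.Carrier W) →
    ¬ ClosureSpace.cl W (⟦_⟧ W a) b → ¬ ClosureSpace.cl W (⟦_⟧ W c) d →
    ∃[ h ] (IsAutomorphism W h × h a ≡ c × h b ≡ d))
    × (¬ ExchangeOver∅ W → IsDLOWithoutEndpoints W)
lemma2p9 EM W homogeneous ∅-closed =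
  pointTransitive , independentPairTransitive , λ ¬exchange →
    let _ , _ , a<b = ¬exchange⇒∃< EM ¬exchange
    in StrictPair.isDLOWithoutEndpoints EM pointTransitive independentPairTransitive a<b
  where open ClosureSpaceProperties W
        open Homogeneous homogeneous ∅-closed
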